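{- Let $(\mathcal{A},\equiv)$ be an equivalence family with underlying set $A=\bigcup\mathcal{A}$, let $B=(B,\textrm{Con}_B,\vdash_B)$ be a general event structure, and let $g:(\mathcal{A},\equiv)\to(\mathcal{C}^\infty(B),=)$ be a map of equivalence families. Then there is a unique map $k:\mathit{col}(\mathcal{A},\equiv)\to B$ of general event structures such that $\mathit{fam}(k)\circ\eta_A=g$, i.e. $k(\{a\}_\equiv)$ is defined iff $g(a)$ is defined, and then $k(\{a\}_\equiv)=g(a)$, for all $a\in A$.
   Context: A general event structure $(E,\textrm{Con},\vdash)$: a set $E$, a non-empty set $\textrm{Con}$ of finite subsets of $E$ closed under subsets, and a relation $\vdash\subseteq\textrm{Con}\times E$ such that $Y\in\textrm{Con}$, $Y\supseteq X$, $X\vdash e$ imply $Y\vdash e$. A configuration is $x\subseteq E$ with every finite subset in $\textrm{Con}$ and such that for every $e\in x$ there are $e_1,\dots,e_n\in x$ with $e_n=e$ and $\{e_1,\dots,e_{i-1}\}\vdash e_i$ for all $i\leq n$; $\mathcal{C}^\infty(E)$ denotes the configurations. A map of general event structures $f:(E,\textrm{Con},\vdash)\to(E',\textrm{Con}',\vdash')$ is a partial function $f:E\rightharpoonup E'$ such that for all $X\in\textrm{Con}$: $fX\in\textrm{Con}'$; $f$ is injective on the elements of $X$ where it is defined; and $X\vdash e$ with $f(e)$ defined implies $fX\vdash'f(e)$. A family of configurations is a non-empty family $\mathcal{A}$ of sets such that finitely compatible subfamilies (every finite subset contained in some member) have union in $\mathcal{A}$, and for $e\in x\in\mathcal{A}$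 there are $e_1,\dots,e_n=e$ in $x$ with $\{e_1,\dots,e_i\}\in\mathcal{A}$ for all $i$. An equivalence family $(\mathcal{A},\equiv_A)$ is such a family with an equivalence relation on $\bigcup\mathcal{A}$. A map of equivalence families $f:(\mathcal{A},\equiv_A)\to(\mathcal{B},\equiv_B)$ is a partial function $\bigcup\mathcal{A}\rightharpoonup\bigcup\mathcal{B}$ preserving $\equiv$ (if $a_1\equiv_A a_2$ then $f(a_1),f(a_2)$ both undefined or both defined and $\equiv_B$-equivalent) such that for $x\in\mathcal{A}$, $fx\in\mathcal{B}$ and for $a_1,a_2\in x$, $f(a_1)\equiv_B f(a_2)$ implies $a_1\equiv_A a_2$. $\mathit{fam}(B)=(\mathcal{C}^\infty(B),=)$ with $=$ the identity on $\bigcup\mathcal{C}^\infty(B)$, and $\mathit{fam}(k)=k$ on maps. $\mathit{col}(\mathcal{A},\equiv)=(E,\textrm{Con},\vdash)$ where $E=A_\equiv$ is the set of $\equiv$-classes of $A$; $X\in\textrm{Con}$ iff $X$ is a finite subset of $y_\equiv=\{\{a\}_\equiv\mid a\in y\}$ for some $y\in\mathcal{A}$; $X\vdash e$ iff $e\in E$, $X\in\textrm{Con}$ and $e\in y_\equiv\subseteq X\cup\{e\}$ for some $y\in\mathcal{A}$. The unit $\eta_A:(\mathcal{A},\equiv)\to\mathit{fam}(\mathit{col}(\mathcal{A},\equiv))$ is $\eta_A(a)=\{a\}_\equiv$. -}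

module Defs where

open import Level using (0ℓ; Level; suc)
open import Data.List using (List; []; _∷_; mapMaybe)
open import Data.List.Relation.Unary.Any using (Any)
open import Data.List.Relation.Unary.All using (All)
open import Data.List.Membership.Propositional using (_∈_)
open import Data.Maybe using (Maybe; just; nothing)
open import Data.Maybe.Relation.Binary.Pointwise using (Pointwise)
open import Data.Product using (Σ; ∃; _×_; proj₁)
open import Data.Sum using (_⊎_)
open import Relation.Binary using (Rel; IsEquivalence)
open import Relation.Binary.PropositionalEquality using (_≡_)
open import Relation.Unary using (Pred)
open import Level using (Lift)
import Level

-- Events form a setoid (Ev, _≈_): this is needed because col(A,≡) has
-- the QUOTIENT A/≡ as its events, which we represent as A with ≡ as
-- event equality.  A general event structure in the paper's sense
-- (plain set of events) is the special case 'discrete' below (≈ = ≡).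
-- Finite subsets of events are represented by lists, considered up to
-- ≈-membership (all axioms are invariant under that).

record GES (ℓ : Level) : Set (suc ℓ) where
  field
    Ev  : Set ℓ
    _≈_ : Rel Ev ℓ
    Con : List Ev → Set ℓ
    _⊢_ : List Ev → Ev → Set ℓ

module _ {ℓ : Level} (E : GES ℓ) where
  open GES E

  Mem : Ev → List Ev → Set ℓ
  Mem e X = Any (λ d → e ≈ d) X

  _⊑_ : List Ev → List Ev → Set ℓ
  X ⊑ Y = All (λ d → Mem d Y) X

  record IsGES : Set ℓ where
    field
      ≈-equiv   : IsEquivalence _≈_
      Con-nonempty : ∃ λ X → Con X
      Con-sub   : ∀ {X Y} → Con Y → X ⊑ Y → Con X
      ⊢-Con     : ∀ {X e} → X ⊢ e → Con X
      ⊢-mono    : ∀ {X Y e} → Con Y → X ⊑ Y → X ⊢ e → Y ⊢ e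
      ⊢-resp    : ∀ {X e e'} → e ≈ e' → X ⊢ e → X ⊢ e'

  -- securing chains, list stored in REVERSE order (last event first):
  -- e ∷ es is a chain iff es is a chain and es ⊢ e
  data Chain : List Ev → Set ℓ where
    []  : Chain []
    _∷_ : ∀ {e es} → es ⊢ e → Chain es → Chain (e ∷ es)

  record Config (x : Pred Ev ℓ) : Set ℓ where
    field
      fin-con : ∀ (X : List Ev) → All x X → Con X
      secured : ∀ {e} → x e → ∃ λ es → All x (e ∷ es) × Chain (e ∷ es)

discrete : (Ev : Set) → (List Ev → Set) → (List Ev → Ev → Set) → GES 0ℓ
discrete Ev Con ⊢ = record { Ev = Ev ; _≈_ = _≡_ ; Con = Con ; _⊢_ = ⊢ }

record GESMap {ℓ ℓ'} (E : GES ℓ) (E' : GES ℓ') : Set (ℓ Level.⊔ ℓ') where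
  open GES E
  open GES E' renaming (Ev to Ev'; _≈_ to _≈'_; Con to Con'; _⊢_ to _⊢'_)
  field
    fun  : Ev → Maybe Ev'
    resp : ∀ {e₁ e₂} → e₁ ≈ e₂ → Pointwise _≈'_ (fun e₁) (fun e₂)
    con  : ∀ {X} → Con X → Con' (mapMaybe fun X)
    inj  : ∀ {X e₁ e₂ c₁ c₂} → Con X → Mem E e₁ X → Mem E e₂ X →
           fun e₁ ≡ just c₁ → fun e₂ ≡ just c₂ → c₁ ≈' c₂ → e₁ ≈ e₂
    ⊢-pres : ∀ {X e e'} → X ⊢ e → fun e ≡ just e' → mapMaybe fun X ⊢' e'

-- Equivalence families.  A family 𝒜 of subsets of an ambient type U,
-- with a relation ∼ on U (only its restriction to ⋃𝒜 matters).

record EqFam : Set₁ where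
  field
    U   : Set
    Fam : Pred (Pred U 0ℓ) 0ℓ
    _∼_ : Rel U 0ℓ

module _ (F : EqFam) where
  open EqFam F

  InU : U → Set₁
  InU a = ∃ λ x → Fam x × x a

  listSet : List U → Pred U 0ℓ
  listSet l a = a ∈ l

  -- chains e₁,…,eₙ (stored reversed) with every {e₁,…,eᵢ} ∈ 𝒜
  data FChain : List U → Set₁ where
    []  : FChain []
    _∷_ : ∀ {e es} → Fam (listSet (e ∷ es)) → FChain es → FChain (e ∷ es)

  record IsFamily : Set₁ where
    field
      -- 𝒜 is a family of SETS: membership in 𝒜 is extensional
      ext      : ∀ {x y} → Fam x → (∀ a → x a → y a) → (∀ a → y a → x a) → Fam y
      nonempty : ∃ λ x → Fam x
      -- finitely compatible subfamilies have their union in 𝒜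
      -- (subfamilies are presented as small-indexed families s : I → 𝒜)
      union    : (I : Set) (s : I → Pred U 0ℓ) → (∀ i → Fam (s i)) →
                 (∀ (is : List I) →
                    ∃ λ y → Fam y × All (λ i → ∀ a → s i a → y a) is) →
                 Fam (λ a → ∃ λ i → s i a)
      secured  : ∀ {x e} → Fam x → x e →
                 ∃ λ es → All x (e ∷ es) × FChain (e ∷ es)

record EqFamMap (F G : EqFam) : Set₁ where
  open EqFam F
  open EqFam G renaming (U to V; Fam to FamG; _∼_ to _∼G_)
  field
    fun  : U → Maybe V
    resp : ∀ {a₁ a₂} → InU F a₁ → InU F a₂ → a₁ ∼ a₂ →
           Pointwise _∼G_ (fun a₁) (fun a₂)
    img  : ∀ {x} → Fam x → FamG (λ b → ∃ λ a → x a × fun a ≡ just b)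
    refl : ∀ {x a₁ a₂ b₁ b₂} → Fam x → x a₁ → x a₂ →
           fun a₁ ≡ just b₁ → fun a₂ ≡ just b₂ → b₁ ∼G b₂ → a₁ ∼ a₂

fam : GES 0ℓ → EqFam
fam B = record { U = GES.Ev B ; Fam = Config B ; _∼_ = _≡_ }

-- col(𝒜,≡).  The event {a}_≡ is represented by (a , proof that a ∈ ⋃𝒜),
-- and two events are equal iff their representatives are ∼-related.
col : EqFam → GES (suc 0ℓ)
col F = record
  { Ev  = Σ U (InU F)
  ; _≈_ = λ d e → Lift (suc 0ℓ) (proj₁ d ∼ proj₁ e)
  ; Con = Con
  ; _⊢_ = λ X e → Con X × ∃ λ y → Fam y ×
            (∃ λ a → y a × a ∼ proj₁ e) ×
            (∀ a → y a → Any (λ d → a ∼ proj₁ d) X ⊎ a ∼ proj₁ e)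
  }
  where
  open EqFam F
  Con : List (Σ U (InU F)) → Set₁
  Con X = ∃ λ y → Fam y × All (λ e → ∃ λ a → y a × a ∼ proj₁ e) X

-- The map k is forced: k({a}_≡) = g(a), so uniqueness is immediate and
-- well-definedness is g's respect of ≡.  A consistent X ⊆ y_≡ is sent into the
-- configuration g y, hence is consistent, and g reflects ≡ on y, so k is
-- injective on X.  If X ⊢ {a}_≡ is witnessed by y with y_≡ ⊆ X ∪ {{a}_≡}, then
-- g y ⊆ kX ∪ {g a}; in a securing chain for g a inside g y, the first
-- occurrence of g a is enabled by earlier events, all of which lie in kX, so
-- kX ⊢ g a by monotonicity of ⊢.
module Submission where

open import Defs
open import Level using (0ℓ; lift; lower)
open import Data.List using (List; mapMaybe)
open import Data.List.Membership.Propositional using (_∈_)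
import Data.List.Relation.Unary.Any as Any
import Data.List.Relation.Unary.Any.Properties as Anyₚ
open import Data.List.Relation.Unary.All as All using (All; []; _∷_)
import Data.List.Relation.Unary.All.Properties as Allₚ
open import Data.Maybe using (Maybe; just; nothing)
open import Data.Maybe.Properties using (just-injective)
import Data.Maybe.Relation.Unary.All as MaybeAll
import Data.Maybe.Relation.Unary.Any as MaybeAny
open import Data.Maybe.Relation.Binary.Pointwise using (Pointwise; just; nothing)
open import Data.Product using (Σ; ∃; _×_; _,_; proj₁; proj₂)
open import Data.Sum using (_⊎_; inj₁; inj₂)
open import Relation.Binary using (IsEquivalence)
open import Relation.Binary.PropositionalEquality using (_≡_; refl; sym; trans; subst)
open import Relation.Unary using (Pred)

Pointwise-≡⇒≡ : ∀ {a} {A : Set a} {m n : Maybe A} → Pointwise _≡_ m n → m ≡ n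
Pointwise-≡⇒≡ (just refl) = refl
Pointwise-≡⇒≡ nothing     = refl

module _ {ℓ} (E : GES ℓ) where
  open GES E

  -- The first occurrence of e in the chain is enabled by the events before it.
  Chain-⊆-or-secures : ∀ {p} {P : Pred Ev p} {e cs} → Chain E cs →
    All (λ c → P c ⊎ c ≡ e) cs → All P cs ⊎ ∃ λ ds → All P ds × ds ⊢ e
  Chain-⊆-or-secures []       []       = inj₁ []
  Chain-⊆-or-secures (p ∷ ch) (q ∷ qs) with Chain-⊆-or-secures ch qs
  ... | inj₂ secures = inj₂ secures
  ... | inj₁ cs⊆P with q
  ...   | inj₁ c∈P  = inj₁ (c∈P ∷ cs⊆P)
  ...   | inj₂ refl = inj₂ (_ , cs⊆P , p)

  Config⊆M∪e⇒M⊢e : ∀ {M x e} → IsGES E → Con M → Config E x → x e →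
    (∀ {c} → x c → Mem E c M ⊎ c ≡ e) → M ⊢ e
  Config⊆M∪e⇒M⊢e isE conM x-config xe cover
    with Config.secured x-config xe
  ... | _ , _ ∷ es⊆x , p ∷ chain
    with Chain-⊆-or-secures chain (All.map cover es⊆x)
  ... | inj₁ es⊑M              = IsGES.⊢-mono isE conM es⊑M p
  ... | inj₂ (_ , ds⊑M , ds⊢e) = IsGES.⊢-mono isE conM ds⊑M ds⊢e

module Extension (F : EqFam) (∼-equiv : IsEquivalence (EqFam._∼_ F))
  {BEv : Set} {BCon : List BEv → Set} {B⊢ : List BEv → BEv → Set}
  (isB : IsGES (discrete BEv BCon B⊢))
  (g : EqFamMap F (fam (discrete BEv BCon B⊢))) where

  open EqFam F
  open IsEquivalence ∼-equiv using () renaming (sym to ∼-sym; trans to ∼-trans)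
  module g = EqFamMap g

  B : GES 0ℓ
  B = discrete BEv BCon B⊢

  Ev : Set₁
  Ev = GES.Ev (col F)

  _∈≡_ : Ev → Pred U 0ℓ → Set
  e ∈≡ y = ∃ λ a → y a × a ∼ proj₁ e

  image : Pred U 0ℓ → Pred BEv 0ℓ
  image y b = ∃ λ a → y a × g.fun a ≡ just b

  k-fun : Ev → Maybe BEv
  k-fun e = g.fun (proj₁ e)

  g-cong : ∀ {y a} (e : Ev) → Fam y → y a → a ∼ proj₁ e → g.fun a ≡ k-fun e
  g-cong e y∈𝒜 ya a∼e = Pointwise-≡⇒≡ (g.resp (_ , y∈𝒜 , ya) (proj₂ e) a∼e)

  ∈≡-lookup : ∀ {y X} (e : Ev) → All (_∈≡ y) X → Mem (col F) e X → e ∈≡ y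
  ∈≡-lookup _ X⊆y e∈X with All.lookupAny X⊆y e∈X
  ... | (a , ya , a∼d) , lift e∼d = a , ya , ∼-trans a∼d (∼-sym e∼d)

  mapMaybe-⊆-image : ∀ {y X} → Fam y → All (_∈≡ y) X →
    All (image y) (mapMaybe k-fun X)
  mapMaybe-⊆-image {y} y∈𝒜 X⊆y =
    Allₚ.mapMaybe⁺ {f = k-fun}
      (Allₚ.map⁺ {P = MaybeAll.All (image y)} {f = k-fun}
        (All.map (λ {e} → k-fun-∈-image e) X⊆y))
    where
    k-fun-∈-image : ∀ e → e ∈≡ y → MaybeAll.All (image y) (k-fun e)
    k-fun-∈-image e (a , ya , a∼e) with k-fun e | g-cong e y∈𝒜 ya a∼e
    ... | just b  | ga≡b = MaybeAll.just (a , ya , ga≡b)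
    ... | nothing | _    = MaybeAll.nothing

  k-con : ∀ {X} → GES.Con (col F) X → BCon (mapMaybe k-fun X)
  k-con (y , y∈𝒜 , X⊆y) = Config.fin-con (g.img y∈𝒜) _ (mapMaybe-⊆-image y∈𝒜 X⊆y)

  k-reflects : ∀ {y c} (e₁ e₂ : Ev) → Fam y → e₁ ∈≡ y → e₂ ∈≡ y →
    k-fun e₁ ≡ just c → k-fun e₂ ≡ just c → proj₁ e₁ ∼ proj₁ e₂
  k-reflects e₁ e₂ y∈𝒜 (a₁ , ya₁ , a₁∼e₁) (a₂ , ya₂ , a₂∼e₂) k₁ k₂ =
    ∼-trans (∼-sym a₁∼e₁) (∼-trans a₁∼a₂ a₂∼e₂)
    where
    a₁∼a₂ : a₁ ∼ a₂
    a₁∼a₂ = g.refl y∈𝒜 ya₁ ya₂ (trans (g-cong e₁ y∈𝒜 ya₁ a₁∼e₁) k₁)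
                               (trans (g-cong e₂ y∈𝒜 ya₂ a₂∼e₂) k₂) refl

  image-⊆-k∪ : ∀ {X y e′} (e : Ev) → Fam y →
    (∀ a → y a → Any.Any (λ d → a ∼ proj₁ d) X ⊎ a ∼ proj₁ e) →
    k-fun e ≡ just e′ → ∀ {b} → image y b → b ∈ mapMaybe k-fun X ⊎ b ≡ e′
  image-⊆-k∪ {X} e y∈𝒜 y⊆X∪e ke {b} (a , ya , ga) with y⊆X∪e a ya
  ... | inj₁ a∈X =
    inj₁ (Anyₚ.mapMaybe⁺ k-fun X
           (Anyₚ.map⁺ {f = k-fun} {P = MaybeAny.Any (b ≡_)}
             (Any.map (λ {d} → k-fun-is-b d) a∈X)))
    where
    k-fun-is-b : ∀ d → a ∼ proj₁ d → MaybeAny.Any (b ≡_) (k-fun d)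
    k-fun-is-b d a∼d =
      subst (MaybeAny.Any (b ≡_)) (trans (sym ga) (g-cong d y∈𝒜 ya a∼d)) (MaybeAny.just refl)
  ... | inj₂ a∼e = inj₂ (just-injective (trans (sym ga) (trans (g-cong e y∈𝒜 ya a∼e) ke)))

  k-inj : ∀ {X} {e₁ e₂ : Ev} {c₁ c₂} →
    GES.Con (col F) X → Mem (col F) e₁ X → Mem (col F) e₂ X →
    k-fun e₁ ≡ just c₁ → k-fun e₂ ≡ just c₂ → c₁ ≡ c₂ → GES._≈_ (col F) e₁ e₂
  k-inj {e₁ = e₁} {e₂} (y , y∈𝒜 , X⊆y) e₁∈X e₂∈X k₁ k₂ refl =
    lift (k-reflects e₁ e₂ y∈𝒜 (∈≡-lookup e₁ X⊆y e₁∈X) (∈≡-lookup e₂ X⊆y e₂∈X) k₁ k₂)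

  k-⊢-pres : ∀ {X} {e : Ev} {e′} →
    GES._⊢_ (col F) X e → k-fun e ≡ just e′ → B⊢ (mapMaybe k-fun X) e′
  k-⊢-pres {e = e} (conX , y , y∈𝒜 , (a , ya , a∼e) , y⊆X∪e) ke =
    Config⊆M∪e⇒M⊢e B isB (k-con conX) (g.img y∈𝒜)
      (a , ya , trans (g-cong e y∈𝒜 ya a∼e) ke) (image-⊆-k∪ e y∈𝒜 y⊆X∪e ke)

  k : GESMap (col F) B
  k = record
    { fun    = k-fun
    ; resp   = λ {e₁} {e₂} e₁≈e₂ → g.resp (proj₂ e₁) (proj₂ e₂) (lower e₁≈e₂)
    ; con    = k-con
    ; inj    = λ {X} {e₁} {e₂} → k-inj {X} {e₁} {e₂}
    ; ⊢-pres = λ {X} {e} → k-⊢-pres {X} {e}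
    }

theorem6p1 : (F : EqFam) → IsFamily F → IsEquivalence (EqFam._∼_ F) →
    (BEv : Set) (BCon : List BEv → Set) (B⊢ : List BEv → BEv → Set) →
    IsGES (discrete BEv BCon B⊢) →
    (g : EqFamMap F (fam (discrete BEv BCon B⊢))) →
    Σ (GESMap (col F) (discrete BEv BCon B⊢)) (λ k →
      (∀ e → GESMap.fun k e ≡ EqFamMap.fun g (proj₁ e)) ×
      (∀ (k' : GESMap (col F) (discrete BEv BCon B⊢)) →
        (∀ e → GESMap.fun k' e ≡ EqFamMap.fun g (proj₁ e)) →
        ∀ e → GESMap.fun k' e ≡ GESMap.fun k e))
theorem6p1 F _ ∼-equiv BEv BCon B⊢ isB g = k , (λ _ → refl) , (λ _ k′≗g → k′≗g)
  where open Extension F ∼-equiv isB g
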